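{- Let $\pi_q$ be a projective plane of order $q$. Let $A(\pi_q)$ denote the minimum number of queries needed, in the worst case, by an adaptive search to determine an unknown point of $\pi_q$, where each query is either a point or a line of $\pi_q$ and the answer to a query is YES if the unknown point is incident with (for a point query: equal to) the queried element and NO otherwise. Then $A(\pi_q)\le 2q-1$. Moreover, if $q$ is a prime power, then $A(\mathrm{PG}(2,q))=2q-1$; equivalently, $A(3,q)=2q-1$.
   Context: Let $q$ be a prime power, $\mathrm{GF}(q)$ the field with $q$ elements, and $V$ an $n$-dimensional vector space over $\mathrm{GF}(q)$. An unknown $1$-dimensional subspace $\mathbf{v}$ of $V$ is to be found. A query is a subspace $U$ of $V$, and the answer is YES if $\mathbf{v}\le U$ and NO otherwise. $A(n,q)$ denotes the minimum number of queries needed (in the worst case) to determine $\mathbf{v}$ in adaptive search, i.e. each query may depend on the answers to previous queries. $\mathrm{PG}(2,q)$ is the Desarguesian projective plane whose points and lines are the $1$- and $2$-dimensional subspaces of a $3$-dimensional vector space over $\mathrm{GF}(q)$. -}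

module Defs where

open import Level using (0ℓ)
open import Data.Nat using (ℕ; zero; suc; _≤_; _⊔_)
open import Data.Fin using (Fin)
open import Data.Fin.Properties using () renaming (_≟_ to _≟F_)
open import Data.Bool using (Bool; true; false; if_then_else_)
open import Data.Product using (Σ; _×_; _,_; ∃)
open import Relation.Nullary using (¬_; does; Dec; yes; no)
open import Relation.Binary.PropositionalEquality using (_≡_; _≢_; cong)
open import Relation.Binary.Definitions using (DecidableEquality)
open import Function.Bundles using (_↔_; Inverse)
open import Algebra.Bundles using (CommutativeRing)

record IncidenceStructure : Set₁ where
  field
    Point : Set
    Line  : Set
    _≟P_  : DecidableEquality Point
    inc   : Point → Line → Bool

  _I_ : Point → Line → Set
  p I L = inc p L ≡ true

module Search (S : IncidenceStructure) where
  open IncidenceStructure S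

  data Query : Set where
    pt : Point → Query
    ln : Line → Query

  answer : Query → Point → Bool
  answer (pt p) x = does (x ≟P p)
  answer (ln L) x = inc x L

  data Strategy : Set where
    leaf : Point → Strategy
    ask  : Query → (ifYes ifNo : Strategy) → Strategy

  run : Strategy → Point → Point
  run (leaf p)    x = p
  run (ask Q y n) x = if answer Q x then run y x else run n x

  depth : Strategy → ℕ
  depth (leaf p)    = zero
  depth (ask Q y n) = suc (depth y ⊔ depth n)

  Determines : Strategy → Set
  Determines T = ∀ x → run T x ≡ x

  A≤ : ℕ → Set
  A≤ k = Σ Strategy λ T → Determines T × depth T ≤ k

  A≡ : ℕ → Set
  A≡ k = A≤ k × (∀ T → Determines T → k ≤ depth T)

record ProjectivePlane (q : ℕ) : Set₁ where
  field
    S : IncidenceStructure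
  open IncidenceStructure S
  field
    join : ∀ {p r} → p ≢ r →
           Σ Line λ L → p I L × r I L × (∀ L′ → p I L′ → r I L′ → L′ ≡ L)
    meet : ∀ {L M} → L ≢ M →
           Σ Point λ p → p I L × p I M × (∀ p′ → p′ I L → p′ I M → p′ ≡ p)
    quadrangle : Σ (Fin 4 → Point) λ f →
                   ∀ i j k → i ≢ j → j ≢ k → i ≢ k →
                   ∀ L → ¬ (f i I L × f j I L × f k I L)
    order : ∀ L → Fin (suc q) ↔ Σ Point (λ p → p I L)

record IsFiniteField (q : ℕ) (F : CommutativeRing 0ℓ 0ℓ) : Set where
  open CommutativeRing F
  field
    ≈⇒≡      : ∀ {x y} → x ≈ y → x ≡ y
    0≢1      : 0# ≢ 1#
    inverse  : ∀ x → x ≢ 0# → ∃ λ y → x * y ≡ 1#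
    card     : Fin q ↔ Carrier

-- The Desarguesian plane PG(2,F)
-- Points = 1-dimensional subspaces of F³, each represented by its unique
-- normalised spanning vector (first nonzero coordinate equal to 1):
--   e1 a b ~ ⟨(1,a,b)⟩,  e2 b ~ ⟨(0,1,b)⟩,  e3 ~ ⟨(0,0,1)⟩.
-- Lines = 2-dimensional subspaces of F³, each represented as the kernel
-- of a normalised nonzero linear functional (same normal form).

module PG2 {q : ℕ} (F : CommutativeRing 0ℓ 0ℓ) (isFF : IsFiniteField q F) where
  open CommutativeRing F
  open IsFiniteField isFF

  _≟C_ : DecidableEquality Carrier
  x ≟C y with Inverse.from card x ≟F Inverse.from card y
  ... | yes e = yes (trans′ (sym′ (Inverse.strictlyInverseˡ card x))
                     (trans′ (cong (Inverse.to card) e) (Inverse.strictlyInverseˡ card y)))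
    where
      open import Relation.Binary.PropositionalEquality using () renaming (trans to trans′; sym to sym′)
  ... | no ne = no λ e → ne (cong (Inverse.from card) e)

  data NVec : Set where
    e1 : Carrier → Carrier → NVec
    e2 : Carrier → NVec
    e3 : NVec

  coords : NVec → Carrier × Carrier × Carrier
  coords (e1 a b) = 1# , a , b
  coords (e2 b)   = 0# , 1# , b
  coords e3       = 0# , 0# , 1#

  _≟N_ : DecidableEquality NVec
  e1 a b ≟N e1 c d with a ≟C c | b ≟C d
  ... | yes refl′ | yes refl″ = yes (cong₂′ e1 refl′ refl″)
    where open import Relation.Binary.PropositionalEquality using () renaming (cong₂ to cong₂′)
  ... | no ne | _ = no λ { Relation.Binary.PropositionalEquality.refl → ne Relation.Binary.PropositionalEquality.refl }
  ... | yes _ | no ne = no λ { Relation.Binary.PropositionalEquality.refl → ne Relation.Binary.PropositionalEquality.refl }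
  e1 _ _ ≟N e2 _ = no λ ()
  e1 _ _ ≟N e3 = no λ ()
  e2 _ ≟N e1 _ _ = no λ ()
  e2 a ≟N e2 b with a ≟C b
  ... | yes e = yes (cong e2 e)
  ... | no ne = no λ { Relation.Binary.PropositionalEquality.refl → ne Relation.Binary.PropositionalEquality.refl }
  e2 _ ≟N e3 = no λ ()
  e3 ≟N e1 _ _ = no λ ()
  e3 ≟N e2 _ = no λ ()
  e3 ≟N e3 = yes Relation.Binary.PropositionalEquality.refl

  dot : NVec → NVec → Carrier
  dot u v with coords u | coords v
  ... | (x₁ , x₂ , x₃) | (y₁ , y₂ , y₃) = x₁ * y₁ + x₂ * y₂ + x₃ * y₃

  PG : IncidenceStructure
  PG = record
    { Point = NVec
    ; Line  = NVec
    ; _≟P_  = _≟N_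
    ; inc   = λ u v → does (dot u v ≟C 0#)
    }

-- Upper bound: take a point P and the q + 1 lines through it. Ask one of them; on
-- YES search its q + 1 points with q point queries. Otherwise ask q - 1 of the others
-- in turn, and on the first YES search that line's q points other than P with q - 1
-- queries; if all say NO, the unknown is one of the q points of the remaining line.
-- In every case at most 2q - 1 queries are used.
--
-- Lower bound for PG(2, q): answering NO as long as some candidate is consistent with
-- it leads any strategy to a point x and at most depth-many queries, all answered NO
-- by x, such that every other point answers YES to one of them. Each such query
-- accepts only points of a line missing x. Deleting the first of these lines leaves an
-- affine plane with x as origin, whose remaining points are covered by the other lines.
-- The product f of their affine equations vanishes off the origin but not at it, so
-- ∑_{s,t} f(s, t) ≠ 0; as ∑_s sᵃ = 0 for a < q - 1, this forces deg f ≥ 2q - 2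
-- (Jamison's theorem), hence at least 2q - 1 queries.

module Submission where

open import Defs
open import Level using (0ℓ)
open import Algebra.Bundles using (CommutativeRing; Semiring)
open import Data.Nat as ℕ using (ℕ; zero; suc; _≤_; _∸_; z≤n; s≤s)
open import Data.Nat.Properties
  using (≤-trans; ≤-reflexive; ≤-pred; <-irrefl; ≰⇒>; n≤1+n; m≤m⊔n; m≤n⊔m; m≤n+m; ⊔-lub; +-suc; +-comm;
         +-cancelˡ-≤; +-monoʳ-≤; ∸-monoˡ-≤; module ≤-Reasoning)
import Data.Nat.Properties as ℕₚ
open import Data.Nat.Tactic.RingSolver using (solve-∀)
open import Data.Bool using (true; false)
open import Data.Bool.Properties using () renaming (_≟_ to _≟ᵇ_)
open import Data.Fin using (Fin; zero; suc; punchIn; punchOut; inject≤)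
open import Data.Fin.Properties
  using (suc-injective; 0≢1+n; punchInᵢ≢i; punchIn-injective; punchIn-punchOut; inject≤-injective; injective⇒≤)
open import Data.List using (List; []; _∷_; _++_; length; map; filter; replicate; allFin; cartesianProductWith)
open import Data.List.Properties using (length-replicate)
open import Data.List.Membership.Propositional using (_∈_; find)
open import Data.List.Membership.Propositional.Properties
  using (∈-filter⁺; ∈-filter⁻; ∈-map⁺; ∈-++⁺ˡ; ∈-++⁺ʳ; ∈-cartesianProductWith⁺; ∈-allFin)
open import Data.List.Relation.Unary.All using (All; []; _∷_)
open import Data.List.Relation.Unary.Any as Any using (Any; here; there; any?)
open import Data.Vec.Functional using (Vector; head; tail; removeAt) renaming (_∷_ to _∷ᵥ_)
import Data.Vec.Functional.Relation.Unary.Any as Vec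
open import Data.Product using (Σ; ∃; _×_; _,_; proj₁; proj₂)
open import Data.Sum using (_⊎_; inj₁; inj₂)
open import Data.Empty using (⊥-elim)
open import Relation.Binary.PropositionalEquality
  using (_≡_; _≢_; refl; sym; trans; cong; cong₂; subst; module ≡-Reasoning)
open import Relation.Nullary using (¬_; yes; no)
open import Relation.Nullary.Decidable using (dec-true)
open import Function using (_∘_)
open import Function.Bundles using (Inverse; Injection)
open import Function.Properties.Inverse using (Inverse⇒Injection; ↔-sym)

distinct⇒2≤n : ∀ {n} {i j : Fin n} → i ≢ j → 2 ≤ n
distinct⇒2≤n {suc zero}    {zero} {zero} i≢j = ⊥-elim (i≢j refl)
distinct⇒2≤n {suc (suc n)} _                 = s≤s (s≤s z≤n)

injectionAvoiding : ∀ {n} (i₀ : Fin n) {k} → suc k ≤ n →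
                    Σ (Fin k → Fin n) λ f → (∀ {i j} → f i ≡ f j → i ≡ j) × (∀ i → f i ≢ i₀)
injectionAvoiding {suc n} i₀ (s≤s k≤n) =
  (λ i → punchIn i₀ (inject≤ i k≤n)) ,
  (λ {i} {j} eq → inject≤-injective k≤n k≤n i j (punchIn-injective i₀ _ _ eq)) ,
  (λ i → punchInᵢ≢i i₀ _)

one-exponent-small : ∀ {q} a b → 3 ℕ.+ (a ℕ.+ b) ≤ q ℕ.+ q → 2 ℕ.+ a ≤ q ⊎ 2 ℕ.+ b ≤ q
one-exponent-small {q} a b bound with 2 ℕ.+ a ℕ.≤? q
... | yes 2+a≤q = inj₁ 2+a≤q
... | no  2+a≰q = inj₂ (+-cancelˡ-≤ (suc a) (2 ℕ.+ b) q (begin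
  suc a ℕ.+ (2 ℕ.+ b)    ≡⟨ shuffle a b ⟩
  3 ℕ.+ (a ℕ.+ b)        ≤⟨ bound ⟩
  q ℕ.+ q                ≤⟨ +-monoʳ-≤ q (≤-pred (≰⇒> 2+a≰q)) ⟩
  q ℕ.+ suc a            ≡⟨ +-comm q (suc a) ⟩
  suc a ℕ.+ q            ∎))
  where
  open ≤-Reasoning
  shuffle : ∀ a b → suc a ℕ.+ (2 ℕ.+ b) ≡ 3 ℕ.+ (a ℕ.+ b)
  shuffle = solve-∀

2q≤2+n⇒2q∸1≤1+n : ∀ {q n} → q ℕ.+ q ≤ 2 ℕ.+ n → 2 ℕ.* q ∸ 1 ≤ suc n
2q≤2+n⇒2q∸1≤1+n {q} {n} bound =
  ∸-monoˡ-≤ 1 (subst (λ m → q ℕ.+ m ≤ 2 ℕ.+ n) (sym (ℕₚ.+-identityʳ q)) bound)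

module SearchStrategies (S : IncidenceStructure) where
  open IncidenceStructure S
  open Search S

  Rejects : Query → Point → Set
  Rejects Q x = answer Q x ≡ false

  Accepts : Query → Point → Set
  Accepts Q x = answer Q x ≡ true

  infix 4 _∈ᵥ_
  _∈ᵥ_ : ∀ {n} → Point → Vector Point n → Set
  x ∈ᵥ v = Vec.Any (_≡ x) v

  linearSearch : ∀ {n} → Vector Point (suc n) → Strategy
  linearSearch {zero}  v = leaf (head v)
  linearSearch {suc n} v = ask (pt (head v)) (leaf (head v)) (linearSearch (tail v))

  linearSearch-depth : ∀ {n} (v : Vector Point (suc n)) → depth (linearSearch v) ≤ n
  linearSearch-depth {zero}  v = z≤n
  linearSearch-depth {suc n} v = s≤s (⊔-lub z≤n (linearSearch-depth (tail v)))

  linearSearch-finds : ∀ {n} (v : Vector Point (suc n)) {x} → x ∈ᵥ v → run (linearSearch v) x ≡ x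
  linearSearch-finds {zero}  v (zero , v₀≡x) = v₀≡x
  linearSearch-finds {suc n} v {x} x∈v with x ≟P head v
  ... | yes x≡v₀ = sym x≡v₀
  linearSearch-finds {suc n} v (zero  , v₀≡x) | no x≢v₀ = ⊥-elim (x≢v₀ (sym v₀≡x))
  linearSearch-finds {suc n} v (suc i , vᵢ≡x) | no _    = linearSearch-finds (tail v) (i , vᵢ≡x)

  sweep : ∀ {m n} → Vector Line m → Vector (Vector Point (suc n)) m → Vector Point (suc n) → Strategy
  sweep {zero}  ℓ cands fallback = linearSearch fallback
  sweep {suc m} ℓ cands fallback =
    ask (ln (head ℓ)) (linearSearch (head cands)) (sweep (tail ℓ) (tail cands) fallback)

  sweep-depth : ∀ {m n} ℓ cands (fallback : Vector Point (suc n)) → depth (sweep {m} ℓ cands fallback) ≤ m ℕ.+ n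
  sweep-depth {zero}      ℓ cands fallback = linearSearch-depth fallback
  sweep-depth {suc m} {n} ℓ cands fallback = s≤s (⊔-lub
    (≤-trans (linearSearch-depth (head cands)) (m≤n+m n m))
    (sweep-depth (tail ℓ) (tail cands) fallback))

  sweep-finds : ∀ {m n} ℓ cands (fallback : Vector Point (suc n)) {x} →
                (∀ i → x I ℓ i → x ∈ᵥ cands i) →
                ((∀ i → Rejects (ln (ℓ i)) x) → x ∈ᵥ fallback) →
                run (sweep {m} ℓ cands fallback) x ≡ x
  sweep-finds {zero}  ℓ cands fallback onLine onNone = linearSearch-finds fallback (onNone λ ())
  sweep-finds {suc m} ℓ cands fallback {x} onLine onNone with inc x (head ℓ) in x∈ℓ₀
  ... | true  = linearSearch-finds (head cands) (onLine zero x∈ℓ₀)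
  ... | false = sweep-finds (tail ℓ) (tail cands) fallback (onLine ∘ suc)
                  λ offTail → onNone λ { zero → x∈ℓ₀ ; (suc i) → offTail i }

  record Pencil (q : ℕ) : Set where
    field
      centre       : Point
      line         : Fin (suc q) → Line
      ray          : Fin (suc q) → Vector Point q
      centre-on    : ∀ i → centre I line i
      ray-complete : ∀ i {x} → x I line i → x ≢ centre → x ∈ᵥ ray i
      covers       : ∀ {x} → x ≢ centre → ∃ λ i → x I line i

  -- Line 1 is asked first, lines 2, …, q are swept, and line 0 is never asked:
  -- a point on none of the others lies on it.
  pencil-A≤ : ∀ {q} → 2 ≤ q → Pencil q → A≤ (2 ℕ.* q ∸ 1)
  pencil-A≤ {suc (suc r)} (s≤s (s≤s z≤n)) pencil = strategy , finds , depth-bound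
    where
    open Pencil pencil

    swept : Fin (suc r) → Fin (suc (suc (suc r)))
    swept i = suc (suc i)

    strategy : Strategy
    strategy = ask (ln (line (suc zero))) (linearSearch (centre ∷ᵥ ray (suc zero)))
                   (sweep (line ∘ swept) (ray ∘ swept) (ray zero))

    onFirst : ∀ {x} → x I line (suc zero) → x ∈ᵥ centre ∷ᵥ ray (suc zero)
    onFirst {x} x∈ℓ₁ with x ≟P centre
    ... | yes x≡c = zero , sym x≡c
    ... | no  x≢c with i , rᵢ≡x ← ray-complete (suc zero) x∈ℓ₁ x≢c = suc i , rᵢ≡x

    offFirst : ∀ {x} → Rejects (ln (line (suc zero))) x → x ≢ centre
    offFirst x∉ℓ₁ refl with () ← trans (sym x∉ℓ₁) (centre-on (suc zero))

    onNone : ∀ {x} → x ≢ centre → Rejects (ln (line (suc zero))) x →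
             (∀ i → Rejects (ln (line (swept i))) x) → x ∈ᵥ ray zero
    onNone x≢c x∉ℓ₁ off with covers x≢c
    ... | zero        , x∈ℓ = ray-complete zero x∈ℓ x≢c
    ... | suc zero    , x∈ℓ with () ← trans (sym x∉ℓ₁) x∈ℓ
    ... | suc (suc i) , x∈ℓ with () ← trans (sym (off i)) x∈ℓ

    finds : Determines strategy
    finds x with inc x (line (suc zero)) in x∈ℓ₁
    ... | true  = linearSearch-finds (centre ∷ᵥ ray (suc zero)) (onFirst x∈ℓ₁)
    ... | false = sweep-finds (line ∘ swept) (ray ∘ swept) (ray zero)
                    (λ i x∈ℓ → ray-complete (swept i) x∈ℓ (offFirst x∈ℓ₁))
                    (onNone (offFirst x∈ℓ₁) x∈ℓ₁)

    depth-bound : depth strategy ≤ 2 ℕ.* suc (suc r) ∸ 1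
    depth-bound = ≤-trans
      (s≤s (⊔-lub (≤-trans (linearSearch-depth (centre ∷ᵥ ray (suc zero))) (s≤s (m≤n+m (suc r) r)))
                  (sweep-depth (line ∘ swept) (ray ∘ swept) (ray zero))))
      (≤-reflexive (cong suc (sym (trans (cong (λ k → r ℕ.+ suc (suc k)) (ℕₚ.+-identityʳ r)) (+-suc r (suc r))))))

  run-accepted : ∀ {x} Q ifYes ifNo → Accepts Q x → run (ask Q ifYes ifNo) x ≡ run ifYes x
  run-accepted _ _ _ accepts rewrite accepts = refl

  run-rejected : ∀ {x} Q ifYes ifNo → Rejects Q x → run (ask Q ifYes ifNo) x ≡ run ifNo x
  run-rejected _ _ _ rejects rewrite rejects = refl

  record Separator (R : List Point) (d : ℕ) : Set where
    field
      point     : Point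
      point∈R   : point ∈ R
      queries   : List Query
      few       : length queries ≤ d
      rejected  : All (λ Q → Rejects Q point) queries
      separated : ∀ {y} → y ∈ R → y ≢ point → Any (λ Q → Accepts Q y) queries

  -- Follow the strategy through the candidates of R, answering NO whenever some
  -- remaining candidate does.
  separator : ∀ T {R x₀} → x₀ ∈ R → (∀ {x} → x ∈ R → run T x ≡ x) → Separator R (depth T)
  separator (leaf p) {R} {x₀} x₀∈R determines = record
    { point = x₀ ; point∈R = x₀∈R ; queries = [] ; few = z≤n ; rejected = []
    ; separated = λ y∈R y≢x₀ → ⊥-elim (y≢x₀ (trans (sym (determines y∈R)) (determines x₀∈R))) }
  separator (ask Q ifYes ifNo) {R} x₀∈R determines with any? (λ x → answer Q x ≟ᵇ false) R
  ... | yes someRejects = record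
    { point = point ; point∈R = proj₁ point∈R′ ; queries = Q ∷ queries
    ; few = s≤s (≤-trans few (m≤n⊔m (depth ifYes) (depth ifNo)))
    ; rejected = proj₂ point∈R′ ∷ rejected
    ; separated = separatedByQ }
    where
    R′ : List Point
    R′ = filter (λ x → answer Q x ≟ᵇ false) R

    determines′ : ∀ {x} → x ∈ R′ → run ifNo x ≡ x
    determines′ x∈R′ with x∈R , x-rejects ← ∈-filter⁻ (λ x → answer Q x ≟ᵇ false) x∈R′ =
      trans (sym (run-rejected Q ifYes ifNo x-rejects)) (determines x∈R)

    rejecter∈R′ : proj₁ (find someRejects) ∈ R′
    rejecter∈R′ with _ , x∈R , x-rejects ← find someRejects =
      ∈-filter⁺ (λ x → answer Q x ≟ᵇ false) x∈R x-rejects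

    open Separator (separator ifNo rejecter∈R′ determines′)
    point∈R′ : point ∈ R × Rejects Q point
    point∈R′ = ∈-filter⁻ (λ x → answer Q x ≟ᵇ false) point∈R

    separatedByQ : ∀ {y} → y ∈ R → y ≢ point → Any (λ Q′ → Accepts Q′ y) (Q ∷ queries)
    separatedByQ {y} y∈R y≢p with answer Q y in y-answer
    ... | true  = here y-answer
    ... | false = there (separated (∈-filter⁺ (λ x → answer Q x ≟ᵇ false) y∈R y-answer) y≢p)
  ... | no noneRejects = record
    { point = point ; point∈R = point∈R ; queries = queries
    ; few = ≤-trans few (≤-trans (m≤m⊔n (depth ifYes) (depth ifNo)) (n≤1+n _))
    ; rejected = rejected ; separated = separated }
    where
    accepted : ∀ {x} → x ∈ R → answer Q x ≡ true
    accepted {x} x∈R with answer Q x in x-answer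
    ... | true  = refl
    ... | false = ⊥-elim (noneRejects (Any.map (λ { refl → x-answer }) x∈R))

    determines′ : ∀ {x} → x ∈ R → run ifYes x ≡ x
    determines′ x∈R = trans (sym (run-accepted Q ifYes ifNo (accepted x∈R))) (determines x∈R)

    open Separator (separator ifYes x₀∈R determines′)

module PlaneSearch {q} (π : ProjectivePlane q) where
  open ProjectivePlane π
  open IncidenceStructure S
  open Search S
  open SearchStrategies S

  pointOn : ∀ L → Fin (suc q) → Point
  pointOn L i = proj₁ (Inverse.to (order L) i)

  pointOn-on : ∀ L i → pointOn L i I L
  pointOn-on L i = proj₂ (Inverse.to (order L) i)

  indexOn : ∀ {L x} → x I L → Fin (suc q)
  indexOn x∈L = Inverse.from (order _) (_ , x∈L)

  pointOn-indexOn : ∀ {L x} (x∈L : x I L) → pointOn L (indexOn x∈L) ≡ x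
  pointOn-indexOn {L} x∈L = cong proj₁ (Inverse.strictlyInverseˡ (order L) (_ , x∈L))

  indexOn-injective : ∀ {L x y} (x∈L : x I L) (y∈L : y I L) → indexOn x∈L ≡ indexOn y∈L → x ≡ y
  indexOn-injective {L} x∈L y∈L eq = cong proj₁ (Injection.injective (Inverse⇒Injection (↔-sym (order L))) eq)

  others : ∀ {L p} → p I L → Vector Point q
  others {L} p∈L = removeAt (pointOn L) (indexOn p∈L)

  others-complete : ∀ {L p x} (p∈L : p I L) → x I L → x ≢ p → x ∈ᵥ others p∈L
  others-complete p∈L x∈L x≢p =
    punchOut i≢j , trans (cong (pointOn _) (punchIn-punchOut i≢j)) (pointOn-indexOn x∈L)
    where
    i≢j : indexOn p∈L ≢ indexOn x∈L
    i≢j eq = x≢p (sym (indexOn-injective p∈L x∈L eq))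

  three-on-line⇒2≤q : ∀ {L x y z} → x I L → y I L → z I L → x ≢ y → y ≢ z → x ≢ z → 2 ≤ q
  three-on-line⇒2≤q {L} {x} {y} {z} x∈L y∈L z∈L x≢y y≢z x≢z = ≤-pred (injective⇒≤ index-injective)
    where
    on : Fin 3 → Σ Point (_I L)
    on zero             = x , x∈L
    on (suc zero)       = y , y∈L
    on (suc (suc zero)) = z , z∈L

    point-injective : ∀ i j → proj₁ (on i) ≡ proj₁ (on j) → i ≡ j
    point-injective zero             zero             _ = refl
    point-injective zero             (suc zero)       e = ⊥-elim (x≢y e)
    point-injective zero             (suc (suc zero)) e = ⊥-elim (x≢z e)
    point-injective (suc zero)       zero             e = ⊥-elim (x≢y (sym e))
    point-injective (suc zero)       (suc zero)       _ = refl
    point-injective (suc zero)       (suc (suc zero)) e = ⊥-elim (y≢z e)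
    point-injective (suc (suc zero)) zero             e = ⊥-elim (x≢z (sym e))
    point-injective (suc (suc zero)) (suc zero)       e = ⊥-elim (y≢z (sym e))
    point-injective (suc (suc zero)) (suc (suc zero)) _ = refl

    index-injective : ∀ {i j} → indexOn (proj₂ (on i)) ≡ indexOn (proj₂ (on j)) → i ≡ j
    index-injective e = point-injective _ _ (indexOn-injective _ _ e)

  pencilThrough : ∀ {P M} → ¬ P I M → Pencil q
  pencilThrough {P} {M} P∉M = record
    { centre       = P
    ; line         = line
    ; ray          = λ i → others (P∈line i)
    ; centre-on    = P∈line
    ; ray-complete = λ i x∈ℓ x≢P → others-complete (P∈line i) x∈ℓ x≢P
    ; covers       = covers
    }
    where
    P≢pointOn : ∀ i → P ≢ pointOn M i
    P≢pointOn i P≡m = P∉M (subst (_I M) (sym P≡m) (pointOn-on M i))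

    line : Fin (suc q) → Line
    line i = proj₁ (join (P≢pointOn i))

    P∈line : ∀ i → P I line i
    P∈line i = proj₁ (proj₂ (join (P≢pointOn i)))

    line-unique : ∀ i {L} → P I L → pointOn M i I L → L ≡ line i
    line-unique i = proj₂ (proj₂ (proj₂ (join (P≢pointOn i)))) _

    covers : ∀ {x} → x ≢ P → ∃ λ i → x I line i
    covers {x} x≢P
      with N , P∈N , x∈N , _ ← join (λ P≡x → x≢P (sym P≡x))
      with m , m∈N , m∈M , _ ← meet {N} {M} (λ N≡M → P∉M (subst (P I_) N≡M P∈N)) =
      indexOn m∈M , subst (x I_) (line-unique (indexOn m∈M) P∈N m∈N′) x∈N
      where
      m∈N′ : pointOn M (indexOn m∈M) I N
      m∈N′ = subst (_I N) (sym (pointOn-indexOn m∈M)) m∈N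

  corner : Fin 4 → Point
  corner = proj₁ quadrangle

  c₀ c₁ c₂ c₃ : Point
  c₀ = corner zero
  c₁ = corner (suc zero)
  c₂ = corner (suc (suc zero))
  c₃ = corner (suc (suc (suc zero)))

  ¬collinear₀₁₂ : ∀ L → ¬ (c₀ I L × c₁ I L × c₂ I L)
  ¬collinear₀₁₂ = proj₂ quadrangle zero (suc zero) (suc (suc zero)) (λ ()) (λ ()) (λ ())

  ¬collinear₀₂₃ : ∀ L → ¬ (c₀ I L × c₂ I L × c₃ I L)
  ¬collinear₀₂₃ = proj₂ quadrangle zero (suc (suc zero)) (suc (suc (suc zero))) (λ ()) (λ ()) (λ ())

  ¬collinear₁₂₃ : ∀ L → ¬ (c₁ I L × c₂ I L × c₃ I L)
  ¬collinear₁₂₃ = proj₂ quadrangle (suc zero) (suc (suc zero)) (suc (suc (suc zero))) (λ ()) (λ ()) (λ ())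

  -- The axioms do not exclude a single point and no lines; that is the only
  -- way for two corners of the quadrangle to coincide.
  c₀≡c₁⇒trivial : c₀ ≡ c₁ → ∀ x → x ≡ c₀
  c₀≡c₁⇒trivial c₀≡c₁ x with x ≟P c₀ | c₀ ≟P c₂
  ... | yes x≡c₀ | _ = x≡c₀
  ... | no _ | no c₀≢c₂ with L , c₀∈L , c₂∈L , _ ← join c₀≢c₂ =
    ⊥-elim (¬collinear₀₁₂ L (c₀∈L , subst (_I L) c₀≡c₁ c₀∈L , c₂∈L))
  ... | no x≢c₀ | yes c₀≡c₂ with L , _ , c₀∈L , _ ← join x≢c₀ =
    ⊥-elim (¬collinear₀₁₂ L (c₀∈L , subst (_I L) c₀≡c₁ c₀∈L , subst (_I L) c₀≡c₂ c₀∈L))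

  module _ (c₀≢c₁ : c₀ ≢ c₁) where
    side : Line
    side = proj₁ (join c₀≢c₁)

    c₀∈side : c₀ I side
    c₀∈side = proj₁ (proj₂ (join c₀≢c₁))

    c₁∈side : c₁ I side
    c₁∈side = proj₁ (proj₂ (proj₂ (join c₀≢c₁)))

    c₂∉side : ¬ c₂ I side
    c₂∉side c₂∈side = ¬collinear₀₁₂ side (c₀∈side , c₁∈side , c₂∈side)

    c₀≢c₂ : c₀ ≢ c₂
    c₀≢c₂ c₀≡c₂ = c₂∉side (subst (_I side) c₀≡c₂ c₀∈side)

    c₂≢c₃ : c₂ ≢ c₃
    c₂≢c₃ c₂≡c₃ with L , c₀∈L , c₂∈L , _ ← join c₀≢c₂ =
      ¬collinear₀₂₃ L (c₀∈L , c₂∈L , subst (_I L) c₂≡c₃ c₂∈L)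

    -- The side c₀c₁ meets the line c₂c₃ in a third point.
    2≤q : 2 ≤ q
    2≤q with N , c₂∈N , c₃∈N , _ ← join c₂≢c₃
        with m , m∈N , m∈side , _ ← meet {N} {side} (λ N≡side → c₂∉side (subst (c₂ I_) N≡side c₂∈N)) =
      three-on-line⇒2≤q c₀∈side c₁∈side m∈side c₀≢c₁
        (λ c₁≡m → ¬collinear₁₂₃ N (subst (_I N) (sym c₁≡m) m∈N , c₂∈N , c₃∈N))
        (λ c₀≡m → ¬collinear₀₂₃ N (subst (_I N) (sym c₀≡m) m∈N , c₂∈N , c₃∈N))

  plane-A≤ : A≤ (2 ℕ.* q ∸ 1)
  plane-A≤ with c₀ ≟P c₁
  ... | yes c₀≡c₁ = leaf c₀ , (λ x → sym (c₀≡c₁⇒trivial c₀≡c₁ x)) , z≤n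
  ... | no  c₀≢c₁ = pencil-A≤ (2≤q c₀≢c₁) (pencilThrough (c₂∉side c₀≢c₁))

module FiniteFieldFacts {q : ℕ} (F : CommutativeRing 0ℓ 0ℓ) (isFF : IsFiniteField q F) where
  open CommutativeRing F using (Carrier; _+_; _*_; -_; 0#; 1#; commutativeSemiring)
  module R = CommutativeRing F
  open import Algebra.Definitions.RawSemiring (Semiring.rawSemiring R.semiring) using (_^_)
  open IsFiniteField isFF
  open PG2 F isFF using (_≟C_)
  open import Algebra.Properties.Ring R.ring using () renaming (-‿distribʳ-* to -‿distribʳ-*≈)
  open import Algebra.Properties.Group R.+-group using (inverseˡ-unique; x∙y⁻¹≈ε⇒x≈y; ε⁻¹≈ε)
  open import Algebra.Properties.CommutativeSemiring.Exp R.commutativeSemiring using (^-distrib-*)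
  open import Algebra.Solver.Ring.NaturalCoefficients.Default commutativeSemiring
    using (solve; _:+_; _:*_; _:=_; con)
  open ≡-Reasoning

  +-identityˡ : ∀ x → 0# + x ≡ x
  +-identityˡ x = ≈⇒≡ (R.+-identityˡ x)

  +-identityʳ : ∀ x → x + 0# ≡ x
  +-identityʳ x = ≈⇒≡ (R.+-identityʳ x)

  *-identityˡ : ∀ x → 1# * x ≡ x
  *-identityˡ x = ≈⇒≡ (R.*-identityˡ x)

  *-identityʳ : ∀ x → x * 1# ≡ x
  *-identityʳ x = ≈⇒≡ (R.*-identityʳ x)

  zeroˡ : ∀ x → 0# * x ≡ 0#
  zeroˡ x = ≈⇒≡ (R.zeroˡ x)

  zeroʳ : ∀ x → x * 0# ≡ 0#
  zeroʳ x = ≈⇒≡ (R.zeroʳ x)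

  *-comm : ∀ x y → x * y ≡ y * x
  *-comm x y = ≈⇒≡ (R.*-comm x y)

  -‿inverseʳ : ∀ x → x + - x ≡ 0#
  -‿inverseʳ x = ≈⇒≡ (R.-‿inverseʳ x)

  -‿distribʳ-* : ∀ x y → x * - y ≡ - (x * y)
  -‿distribʳ-* x y = ≈⇒≡ (R.sym (-‿distribʳ-*≈ x y))

  x+y≡0⇒x≡-y : ∀ {x y} → x + y ≡ 0# → x ≡ - y
  x+y≡0⇒x≡-y {x} {y} x+y≡0 = ≈⇒≡ (inverseˡ-unique x y (R.reflexive x+y≡0))

  x-y≡0⇒x≡y : ∀ {x y} → x + - y ≡ 0# → x ≡ y
  x-y≡0⇒x≡y {x} {y} x-y≡0 = ≈⇒≡ (x∙y⁻¹≈ε⇒x≈y x y (R.reflexive x-y≡0))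

  x≡x+y⇒y≡0 : ∀ {x y} → x ≡ x + y → y ≡ 0#
  x≡x+y⇒y≡0 {x} {y} x≡x+y = begin
    y               ≡⟨ sym (+-identityʳ y) ⟩
    y + 0#          ≡⟨ cong (y +_) (sym (-‿inverseʳ x)) ⟩
    y + (x + - x)   ≡⟨ ≈⇒≡ (solve 3 (λ x y -x → y :+ (x :+ -x) := (x :+ y) :+ -x) R.refl x y (- x)) ⟩
    (x + y) + - x   ≡⟨ cong (_+ - x) (sym x≡x+y) ⟩
    x + - x         ≡⟨ -‿inverseʳ x ⟩
    0#              ∎

  _⁻¹[_] : ∀ x → x ≢ 0# → Carrier
  x ⁻¹[ x≢0 ] = proj₁ (inverse x x≢0)

  *-inverseʳ : ∀ x (x≢0 : x ≢ 0#) → x * x ⁻¹[ x≢0 ] ≡ 1#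
  *-inverseʳ x x≢0 = proj₂ (inverse x x≢0)

  *-inverseˡ : ∀ x (x≢0 : x ≢ 0#) → x ⁻¹[ x≢0 ] * x ≡ 1#
  *-inverseˡ x x≢0 = trans (*-comm _ x) (*-inverseʳ x x≢0)

  x*y≡0⇒y≡0 : ∀ {x y} → x ≢ 0# → x * y ≡ 0# → y ≡ 0#
  x*y≡0⇒y≡0 {x} {y} x≢0 xy≡0 = begin
    y                       ≡⟨ sym (*-identityˡ y) ⟩
    1# * y                  ≡⟨ cong (_* y) (sym (*-inverseˡ x x≢0)) ⟩
    x ⁻¹[ x≢0 ] * x * y     ≡⟨ ≈⇒≡ (R.*-assoc _ x y) ⟩
    x ⁻¹[ x≢0 ] * (x * y)   ≡⟨ cong (x ⁻¹[ x≢0 ] *_) xy≡0 ⟩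
    x ⁻¹[ x≢0 ] * 0#        ≡⟨ zeroʳ _ ⟩
    0#                      ∎

  *-cancelˡ : ∀ {x y z} → x ≢ 0# → x * y ≡ x * z → y ≡ z
  *-cancelˡ {x} {y} {z} x≢0 xy≡xz = x-y≡0⇒x≡y (x*y≡0⇒y≡0 x≢0 (begin
    x * (y + - z)       ≡⟨ ≈⇒≡ (R.distribˡ x y (- z)) ⟩
    x * y + x * - z     ≡⟨ cong₂ _+_ xy≡xz (-‿distribʳ-* x z) ⟩
    x * z + - (x * z)   ≡⟨ -‿inverseʳ (x * z) ⟩
    0#                  ∎))

  xy+y[-x]≡0 : ∀ x y → x * y + y * - x ≡ 0#
  xy+y[-x]≡0 x y = trans (cong (x * y +_) (trans (-‿distribʳ-* y x) (cong -_ (*-comm y x)))) (-‿inverseʳ (x * y))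

  -0≡0 : - 0# ≡ 0#
  -0≡0 = ≈⇒≡ ε⁻¹≈ε

  x*-1≡-x : ∀ x → x * - 1# ≡ - x
  x*-1≡-x x = trans (-‿distribʳ-* x 1#) (cong -_ (*-identityʳ x))

  -x≢0 : ∀ {x} → x ≢ 0# → - x ≢ 0#
  -x≢0 {x} x≢0 -x≡0 = x≢0 (trans (sym (+-identityʳ x)) (trans (cong (x +_) (sym -x≡0)) (-‿inverseʳ x)))

  -1≢0 : - 1# ≢ 0#
  -1≢0 = -x≢0 (0≢1 ∘ sym)

  element : Fin q → Carrier
  element = Inverse.to card

  index : Carrier → Fin q
  index = Inverse.from card

  element-index : ∀ x → element (index x) ≡ x
  element-index = Inverse.strictlyInverseˡ card

  element-injective : ∀ {i j} → element i ≡ element j → i ≡ j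
  element-injective = Injection.injective (Inverse⇒Injection card)

  open import Algebra.Properties.Semiring.Sum R.semiring
    using (sum; sum-cong-≗; ∑-distrib-+; *-distribˡ-sum; sum-permute; sum-remove; sum-replicate-zero)
  open import Data.Fin.Permutation using (Permutation; permutation)

  sum-point : ∀ {n} (t : Fin n → Carrier) i → (∀ j → j ≢ i → t j ≡ 0#) → sum t ≡ t i
  sum-point {suc n} t i vanishes = begin
    sum t                          ≡⟨ ≈⇒≡ (sum-remove {i = i} t) ⟩
    t i + sum (t ∘ punchIn i)      ≡⟨ cong (t i +_) (sum-cong-≗ {n} λ j →
                                        vanishes (punchIn i j) (punchInᵢ≢i i j)) ⟩
    t i + sum {n} (λ _ → 0#)       ≡⟨ cong (t i +_) (≈⇒≡ (sum-replicate-zero n)) ⟩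
    t i + 0#                       ≡⟨ +-identityʳ (t i) ⟩
    t i                            ∎

  ∑ : (Carrier → Carrier) → Carrier
  ∑ h = sum (h ∘ element)

  ∑-cong : ∀ {h g} → (∀ x → h x ≡ g x) → ∑ h ≡ ∑ g
  ∑-cong h≗g = sum-cong-≗ (h≗g ∘ element)

  ∑-+ : ∀ h g → ∑ (λ x → h x + g x) ≡ ∑ h + ∑ g
  ∑-+ h g = ≈⇒≡ (∑-distrib-+ (h ∘ element) (g ∘ element))

  ∑-* : ∀ c h → ∑ (λ x → c * h x) ≡ c * ∑ h
  ∑-* c h = ≈⇒≡ (R.sym (*-distribˡ-sum c (h ∘ element)))

  ∑-zero : ∀ h → (∀ x → h x ≡ 0#) → ∑ h ≡ 0#
  ∑-zero h h≗0 = trans (sum-cong-≗ (h≗0 ∘ element)) (≈⇒≡ (sum-replicate-zero q))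

  ∑-point : ∀ h x₀ → (∀ x → x ≢ x₀ → h x ≡ 0#) → ∑ h ≡ h x₀
  ∑-point h x₀ vanishes =
    trans (sum-point (h ∘ element) (index x₀) λ j j≢ → vanishes (element j) λ eⱼ≡x₀ →
             j≢ (element-injective (trans eⱼ≡x₀ (sym (element-index x₀)))))
          (cong h (element-index x₀))

  ∑-reindex : ∀ h (φ ψ : Carrier → Carrier) → (∀ x → φ (ψ x) ≡ x) → (∀ x → ψ (φ x) ≡ x) →
              ∑ h ≡ ∑ (h ∘ φ)
  ∑-reindex h φ ψ φψ ψφ = trans (≈⇒≡ (sum-permute (h ∘ element) π))
                               (sum-cong-≗ λ i → cong h (element-index (φ (element i))))
    where
    conjugate : ∀ (f g : Carrier → Carrier) → (∀ x → f (g x) ≡ x) →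
                ∀ i → index (f (element (index (g (element i))))) ≡ i
    conjugate f g fg i =
      trans (cong (index ∘ f) (element-index _)) (trans (cong index (fg _)) (Inverse.strictlyInverseʳ card i))

    π : Permutation q q
    π = permutation (index ∘ φ ∘ element) (index ∘ ψ ∘ element) (conjugate φ ψ φψ) (conjugate ψ φ ψφ)

  -- evalMonic (c₀ ∷ … ∷ cₙ₋₁) x = c₀ + c₁ x + … + cₙ₋₁ xⁿ⁻¹ + xⁿ
  evalMonic : List Carrier → Carrier → Carrier
  evalMonic []       x = 1#
  evalMonic (c ∷ cs) x = c + x * evalMonic cs x

  -- The quotient of c + x · (monic cs) by x - r, which does not depend on c.
  quotient : Carrier → List Carrier → List Carrier
  quotient r []       = []
  quotient r (c ∷ cs) = evalMonic (c ∷ cs) r ∷ quotient r cs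

  length-quotient : ∀ r cs → length (quotient r cs) ≡ length cs
  length-quotient r []       = refl
  length-quotient r (c ∷ cs) = cong suc (length-quotient r cs)

  x≡[x-r]+r : ∀ x r → x ≡ (x + - r) + r
  x≡[x-r]+r x r = sym (begin
    (x + - r) + r   ≡⟨ ≈⇒≡ (R.+-assoc x (- r) r) ⟩
    x + (- r + r)   ≡⟨ cong (x +_) (≈⇒≡ (R.-‿inverseˡ r)) ⟩
    x + 0#          ≡⟨ +-identityʳ x ⟩
    x               ∎)

  -- Written with x = d + r, where d = x - r, the identity needs no subtraction.
  evalMonic-divide : ∀ c cs r x →
    evalMonic (c ∷ cs) x ≡ (x + - r) * evalMonic (quotient r cs) x + evalMonic (c ∷ cs) r
  evalMonic-divide c [] r x = begin
    c + x * 1#                      ≡⟨ cong (λ y → c + y * 1#) (x≡[x-r]+r x r) ⟩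
    c + ((x + - r) + r) * 1#        ≡⟨ ≈⇒≡ (solve 3 (λ c d r → c :+ (d :+ r) :* con 1
                                                         := d :* con 1 :+ (c :+ r :* con 1))
                                                R.refl c (x + - r) r) ⟩
    (x + - r) * 1# + (c + r * 1#)   ∎
  evalMonic-divide c (c′ ∷ cs) r x = begin
    c + x * evalMonic (c′ ∷ cs) x    ≡⟨ cong (λ y → c + x * y) (evalMonic-divide c′ cs r x) ⟩
    c + x * (d * q′ + p)             ≡⟨ cong (λ y → c + y * (d * q′ + p)) (x≡[x-r]+r x r) ⟩
    c + (d + r) * (d * q′ + p)       ≡⟨ ≈⇒≡ (solve 5 (λ c d r q′ p → c :+ (d :+ r) :* (d :* q′ :+ p)
                                                      := d :* (p :+ (d :+ r) :* q′) :+ (c :+ r :* p))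
                                                 R.refl c d r q′ p) ⟩
    d * (p + (d + r) * q′) + (c + r * p)  ≡⟨ cong (λ y → d * (p + y * q′) + (c + r * p)) (sym (x≡[x-r]+r x r)) ⟩
    d * (p + x * q′) + (c + r * p)   ∎
    where
    d p q′ : Carrier
    d  = x + - r
    p  = evalMonic (c′ ∷ cs) r
    q′ = evalMonic (quotient r cs) x

  roots≤degree : ∀ {k} cs (root : Fin k → Carrier) → (∀ {i j} → root i ≡ root j → i ≡ j) →
                 (∀ i → evalMonic cs (root i) ≡ 0#) → k ≤ length cs
  roots≤degree {zero}  cs       root injective isRoot = z≤n
  roots≤degree {suc k} []       root injective isRoot = ⊥-elim (0≢1 (sym (isRoot zero)))
  roots≤degree {suc k} (c ∷ cs) root injective isRoot =
    s≤s (subst (k ≤_) (length-quotient r cs)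
      (roots≤degree (quotient r cs) (root ∘ suc) (suc-injective ∘ injective) isRoot′))
    where
    r : Carrier
    r = root zero

    isRoot′ : ∀ i → evalMonic (quotient r cs) (root (suc i)) ≡ 0#
    isRoot′ i = x*y≡0⇒y≡0 (λ d≡0 → 0≢1+n (injective (sym (x-y≡0⇒x≡y d≡0)))) (begin
      d * v                          ≡⟨ sym (+-identityʳ (d * v)) ⟩
      d * v + 0#                     ≡⟨ cong (d * v +_) (sym (isRoot zero)) ⟩
      d * v + evalMonic (c ∷ cs) r   ≡⟨ sym (evalMonic-divide c cs r (root (suc i))) ⟩
      evalMonic (c ∷ cs) (root (suc i)) ≡⟨ isRoot (suc i) ⟩
      0#                             ∎)
      where
      d v : Carrier
      d = root (suc i) + - r
      v = evalMonic (quotient r cs) (root (suc i))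

  evalMonic-replicate : ∀ n x → evalMonic (replicate n 0#) x ≡ x ^ n
  evalMonic-replicate zero    x = refl
  evalMonic-replicate (suc n) x = trans (+-identityˡ _) (cong (x *_) (evalMonic-replicate n x))

  -- ∑ x = ∑ (x + 1) = ∑ x + ∑ 1
  ∑-one : ∑ (λ _ → 1#) ≡ 0#
  ∑-one = x≡x+y⇒y≡0 (trans (∑-reindex (λ x → x) (_+ 1#) (_+ - 1#) shift-back shift-forth)
                           (∑-+ (λ x → x) (λ _ → 1#)))
    where
    shift-back : ∀ x → (x + - 1#) + 1# ≡ x
    shift-back x = sym (x≡[x-r]+r x 1#)

    shift-forth : ∀ x → (x + 1#) + - 1# ≡ x
    shift-forth x = trans (≈⇒≡ (R.+-assoc x 1# (- 1#))) (trans (cong (x +_) (-‿inverseʳ 1#)) (+-identityʳ x))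

  nonzero-elements : ∀ {k} → suc k ≤ q →
                     Σ (Fin k → Carrier) λ u → (∀ {i j} → u i ≡ u j → i ≡ j) × (∀ i → u i ≢ 0#)
  nonzero-elements k<q with f , f-injective , f≢index0 ← injectionAvoiding (index 0#) k<q =
    element ∘ f , f-injective ∘ element-injective ,
    λ i fᵢ≡0 → f≢index0 i (element-injective (trans fᵢ≡0 (sym (element-index 0#))))

  -- Substitute x ↦ α x.
  ∑-pow-homogeneous : ∀ n α → α ≢ 0# → α ^ n * ∑ (_^ n) ≡ ∑ (_^ n)
  ∑-pow-homogeneous n α α≢0 = begin
    α ^ n * ∑ (_^ n)            ≡⟨ sym (∑-* (α ^ n) (_^ n)) ⟩
    ∑ (λ x → α ^ n * x ^ n)     ≡⟨ ∑-cong (λ x → ≈⇒≡ (R.sym (^-distrib-* α x n))) ⟩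
    ∑ (λ x → (α * x) ^ n)       ≡⟨ sym (∑-reindex (_^ n) (α *_) (α ⁻¹[ α≢0 ] *_)
                                                  (cancel (*-inverseʳ α α≢0)) (cancel (*-inverseˡ α α≢0))) ⟩
    ∑ (_^ n)                    ∎
    where
    cancel : ∀ {a b} → a * b ≡ 1# → ∀ x → a * (b * x) ≡ x
    cancel {a} {b} ab≡1 x = trans (≈⇒≡ (R.sym (R.*-assoc a b x))) (trans (cong (_* x) ab≡1) (*-identityˡ x))

  -- xⁿ⁺¹ - 1 has at most n + 1 roots, but there are q - 1 ≥ n + 2 units.
  units-not-roots : ∀ n → 3 ℕ.+ n ≤ q → ¬ (∀ α → α ≢ 0# → α ^ suc n ≡ 1#)
  units-not-roots n 3+n≤q all-roots with u , u-injective , u≢0 ← nonzero-elements 3+n≤q =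
    <-irrefl (cong suc (sym (length-replicate n {0#}))) (roots≤degree (- 1# ∷ replicate n 0#) u u-injective isRoot)
    where
    isRoot : ∀ i → evalMonic (- 1# ∷ replicate n 0#) (u i) ≡ 0#
    isRoot i = begin
      - 1# + u i * evalMonic (replicate n 0#) (u i)  ≡⟨ cong (λ y → - 1# + u i * y) (evalMonic-replicate n (u i)) ⟩
      - 1# + u i ^ suc n                            ≡⟨ cong (- 1# +_) (all-roots (u i) (u≢0 i)) ⟩
      - 1# + 1#                                     ≡⟨ ≈⇒≡ (R.-‿inverseˡ 1#) ⟩
      0#                                            ∎

  ∑-pow : ∀ n → 2 ℕ.+ n ≤ q → ∑ (_^ n) ≡ 0#
  ∑-pow zero    _       = ∑-one
  ∑-pow (suc n) 3+n≤q with ∑ (_^ suc n) ≟C 0#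
  ... | yes ∑≡0 = ∑≡0
  ... | no  ∑≢0 = ⊥-elim (units-not-roots n 3+n≤q λ α α≢0 → *-cancelˡ ∑≢0 (begin
    ∑ (_^ suc n) * α ^ suc n   ≡⟨ *-comm _ (α ^ suc n) ⟩
    α ^ suc n * ∑ (_^ suc n)   ≡⟨ ∑-pow-homogeneous (suc n) α α≢0 ⟩
    ∑ (_^ suc n)               ≡⟨ sym (*-identityʳ _) ⟩
    ∑ (_^ suc n) * 1#          ∎))

  record AffineForm : Set where
    constructor affine
    field
      const coeffˢ coeffᵗ : Carrier

  _⟨_,_⟩ : AffineForm → Carrier → Carrier → Carrier
  affine c α β ⟨ s , t ⟩ = c + α * s + β * t

  ∏ : List AffineForm → Carrier → Carrier → Carrier
  ∏ []       s t = 1#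
  ∏ (f ∷ fs) s t = f ⟨ s , t ⟩ * ∏ fs s t

  ∑² : (Carrier → Carrier → Carrier) → Carrier
  ∑² h = ∑ λ s → ∑ λ t → h s t

  ∑²-cong : ∀ {h g} → (∀ s t → h s t ≡ g s t) → ∑² h ≡ ∑² g
  ∑²-cong h≗g = ∑-cong λ s → ∑-cong (h≗g s)

  ∑²-+ : ∀ h g → ∑² (λ s t → h s t + g s t) ≡ ∑² h + ∑² g
  ∑²-+ h g = trans (∑-cong λ s → ∑-+ (h s) (g s)) (∑-+ (λ s → ∑ (h s)) (λ s → ∑ (g s)))

  ∑²-* : ∀ c h → ∑² (λ s t → c * h s t) ≡ c * ∑² h
  ∑²-* c h = trans (∑-cong λ s → ∑-* c (h s)) (∑-* c (λ s → ∑ (h s)))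

  ∑²-point : ∀ h → (∀ s t → ¬ (s ≡ 0# × t ≡ 0#) → h s t ≡ 0#) → ∑² h ≡ h 0# 0#
  ∑²-point h vanishes =
    trans (∑-point _ 0# λ s s≢0 → ∑-zero (h s) λ t → vanishes s t (s≢0 ∘ proj₁))
          (∑-point (h 0#) 0# λ t t≢0 → vanishes 0# t (t≢0 ∘ proj₂))

  monomial×∏ : ℕ → ℕ → List AffineForm → Carrier → Carrier → Carrier
  monomial×∏ a b fs s t = s ^ a * (t ^ b * ∏ fs s t)

  ∑²-monomial : ∀ a b → 3 ℕ.+ (a ℕ.+ b) ≤ q ℕ.+ q → ∑² (monomial×∏ a b []) ≡ 0#
  ∑²-monomial a b bound with one-exponent-small a b bound
  ... | inj₁ 2+a≤q = begin
    ∑² (monomial×∏ a b [])           ≡⟨ ∑-cong (λ s → trans (∑-* (s ^ a) (λ t → t ^ b * 1#))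
                                                           (*-comm (s ^ a) Tb)) ⟩
    ∑ (λ s → Tb * s ^ a)             ≡⟨ ∑-* Tb (_^ a) ⟩
    Tb * ∑ (_^ a)                    ≡⟨ cong (Tb *_) (∑-pow a 2+a≤q) ⟩
    Tb * 0#                          ≡⟨ zeroʳ Tb ⟩
    0#                               ∎
    where
    Tb : Carrier
    Tb = ∑ (λ t → t ^ b * 1#)
  ... | inj₂ 2+b≤q = ∑-zero _ λ s → begin
    ∑ (λ t → s ^ a * (t ^ b * 1#))  ≡⟨ ∑-* (s ^ a) (λ t → t ^ b * 1#) ⟩
    s ^ a * ∑ (λ t → t ^ b * 1#)    ≡⟨ cong (s ^ a *_) (trans (∑-cong (λ t → *-identityʳ (t ^ b)))
                                                              (∑-pow b 2+b≤q)) ⟩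
    s ^ a * 0#                      ≡⟨ zeroʳ (s ^ a) ⟩
    0#                              ∎

  -- Expanding one affine factor trades it for one more power of s or of t.
  ∑²-monomial×∏ : ∀ fs a b → 3 ℕ.+ (a ℕ.+ b ℕ.+ length fs) ≤ q ℕ.+ q → ∑² (monomial×∏ a b fs) ≡ 0#
  ∑²-monomial×∏ [] a b bound =
    ∑²-monomial a b (subst (λ n → 3 ℕ.+ n ≤ q ℕ.+ q) (ℕₚ.+-identityʳ (a ℕ.+ b)) bound)
  ∑²-monomial×∏ (affine c α β ∷ fs) a b bound = begin
    ∑² (monomial×∏ a b (affine c α β ∷ fs))
      ≡⟨ ∑²-cong expand ⟩
    ∑² (λ s t → c * m₀ s t + (α * mˢ s t + β * mᵗ s t))
      ≡⟨ ∑²-+ (λ s t → c * m₀ s t) (λ s t → α * mˢ s t + β * mᵗ s t) ⟩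
    ∑² (λ s t → c * m₀ s t) + ∑² (λ s t → α * mˢ s t + β * mᵗ s t)
      ≡⟨ cong₂ _+_ (∑²-* c m₀) (trans (∑²-+ (λ s t → α * mˢ s t) (λ s t → β * mᵗ s t))
                                      (cong₂ _+_ (∑²-* α mˢ) (∑²-* β mᵗ))) ⟩
    c * ∑² m₀ + (α * ∑² mˢ + β * ∑² mᵗ)
      ≡⟨ cong₂ _+_ (cong (c *_) (∑²-monomial×∏ fs a b fewer))
                   (cong₂ _+_ (cong (α *_) (∑²-monomial×∏ fs (suc a) b moreˢ))
                              (cong (β *_) (∑²-monomial×∏ fs a (suc b) moreᵗ))) ⟩
    c * 0# + (α * 0# + β * 0#)
      ≡⟨ ≈⇒≡ (solve 3 (λ c α β → c :* con 0 :+ (α :* con 0 :+ β :* con 0) := con 0) R.refl c α β) ⟩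
    0# ∎
    where
    m₀ mˢ mᵗ : Carrier → Carrier → Carrier
    m₀ = monomial×∏ a b fs
    mˢ = monomial×∏ (suc a) b fs
    mᵗ = monomial×∏ a (suc b) fs

    expand : ∀ s t → monomial×∏ a b (affine c α β ∷ fs) s t ≡ c * m₀ s t + (α * mˢ s t + β * mᵗ s t)
    expand s t = ≈⇒≡ (solve 8 (λ s t c α β A B P →
        A :* (B :* ((c :+ α :* s :+ β :* t) :* P))
          := c :* (A :* (B :* P)) :+ (α :* ((s :* A) :* (B :* P)) :+ β :* (A :* ((t :* B) :* P))))
      R.refl s t c α β (s ^ a) (t ^ b) (∏ fs s t))

    n : ℕ
    n = length fs

    fewer : 3 ℕ.+ (a ℕ.+ b ℕ.+ n) ≤ q ℕ.+ q
    fewer = ≤-trans (s≤s (s≤s (s≤s (+-monoʳ-≤ (a ℕ.+ b) (n≤1+n n))))) bound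

    moreˢ : 3 ℕ.+ (suc a ℕ.+ b ℕ.+ n) ≤ q ℕ.+ q
    moreˢ = subst (λ m → 3 ℕ.+ m ≤ q ℕ.+ q) (shift a b n) bound
      where
      shift : ∀ a b n → a ℕ.+ b ℕ.+ suc n ≡ suc a ℕ.+ b ℕ.+ n
      shift = solve-∀

    moreᵗ : 3 ℕ.+ (a ℕ.+ suc b ℕ.+ n) ≤ q ℕ.+ q
    moreᵗ = subst (λ m → 3 ℕ.+ m ≤ q ℕ.+ q) (shift a b n) bound
      where
      shift : ∀ a b n → a ℕ.+ b ℕ.+ suc n ≡ a ℕ.+ suc b ℕ.+ n
      shift = solve-∀

  ∏-origin≢0 : ∀ fs → All (λ f → AffineForm.const f ≢ 0#) fs → ∏ fs 0# 0# ≢ 0#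
  ∏-origin≢0 []                   []             1≡0 = 0≢1 (sym 1≡0)
  ∏-origin≢0 (affine c α β ∷ fs) (c≢0 ∷ consts≢0) ∏≡0 =
    ∏-origin≢0 fs consts≢0 (x*y≡0⇒y≡0 (c≢0 ∘ trans (sym value)) ∏≡0)
    where
    value : c + α * 0# + β * 0# ≡ c
    value = ≈⇒≡ (solve 3 (λ c α β → c :+ α :* con 0 :+ β :* con 0 := c) R.refl c α β)

  covering-bound : ∀ fs → All (λ f → AffineForm.const f ≢ 0#) fs →
                   (∀ s t → ¬ (s ≡ 0# × t ≡ 0#) → ∏ fs s t ≡ 0#) → q ℕ.+ q ≤ 2 ℕ.+ length fs
  covering-bound fs consts≢0 covers with q ℕ.+ q ℕ.≤? 2 ℕ.+ length fs
  ... | yes bound = bound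
  ... | no  2+n≱2q = ⊥-elim (∏-origin≢0 fs consts≢0 (begin
    ∏ fs 0# 0#                 ≡⟨ sym (∑²-point (∏ fs) covers) ⟩
    ∑² (∏ fs)                  ≡⟨ ∑²-cong (λ s t → sym (trans (*-identityˡ (1# * ∏ fs s t))
                                                                (*-identityˡ (∏ fs s t)))) ⟩
    ∑² (monomial×∏ 0 0 fs)     ≡⟨ ∑²-monomial×∏ fs 0 0 (≰⇒> 2+n≱2q) ⟩
    0#                         ∎))

  2≤q : 2 ≤ q
  2≤q = distinct⇒2≤n λ index0≡index1 →
    0≢1 (trans (sym (element-index 0#)) (trans (cong element index0≡index1) (element-index 1#)))

module Desarguesian {q : ℕ} (F : CommutativeRing 0ℓ 0ℓ) (isFF : IsFiniteField q F) where
  open CommutativeRing F using (Carrier; _+_; _*_; -_; 0#; 1#; commutativeSemiring)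
  open IsFiniteField isFF using (0≢1; ≈⇒≡)
  open FiniteFieldFacts F isFF
  open PG2 F isFF
  open IncidenceStructure PG using (_I_)
  open Search PG
  open SearchStrategies PG
  open import Algebra.Solver.Ring.NaturalCoefficients.Default commutativeSemiring
    using (solve; _:+_; _:*_; _:=_; con)
  open ≡-Reasoning

  V3 : Set
  V3 = Carrier × Carrier × Carrier

  infixl 7 _·_
  _·_ : V3 → V3 → Carrier
  (x₁ , x₂ , x₃) · (y₁ , y₂ , y₃) = x₁ * y₁ + x₂ * y₂ + x₃ * y₃

  dot≡· : ∀ u v → dot u v ≡ coords u · coords v
  dot≡· u v with coords u | coords v
  ... | _ | _ = refl

  I⇒·≡0 : ∀ x L → x I L → coords x · coords L ≡ 0#
  I⇒·≡0 x L x∈L with dot x L ≟C 0# | x∈L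
  ... | yes dot≡0 | _ = trans (sym (dot≡· x L)) dot≡0

  ·≡0⇒I : ∀ x L → coords x · coords L ≡ 0# → x I L
  ·≡0⇒I x L ·≡0 = dec-true (dot x L ≟C 0#) (trans (dot≡· x L) ·≡0)

  ¬I⇒·≢0 : ∀ x L → Rejects (ln L) x → coords x · coords L ≢ 0#
  ¬I⇒·≢0 x L x∉L ·≡0 with () ← trans (sym x∉L) (·≡0⇒I x L ·≡0)

  -- The point of the line x + m y = 0 with last normalised coordinate b:
  -- (1 : -1/m : b), or (0 : 1 : b) if m = 0.
  pointOnLine : Carrier → Carrier → NVec
  pointOnLine m b with m ≟C 0#
  ... | yes _   = e2 b
  ... | no m≢0 = e1 (- m ⁻¹[ m≢0 ]) b

  pointOnLine-vertical : ∀ {m} b → m ≡ 0# → pointOnLine m b ≡ e2 b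
  pointOnLine-vertical {m} b m≡0 with m ≟C 0#
  ... | yes _   = refl
  ... | no m≢0 = ⊥-elim (m≢0 m≡0)

  1+am≡0⇒a≡-m⁻¹ : ∀ {a m} (m≢0 : m ≢ 0#) → 1# + a * m ≡ 0# → a ≡ - m ⁻¹[ m≢0 ]
  1+am≡0⇒a≡-m⁻¹ {a} {m} m≢0 1+am≡0 = *-cancelˡ m≢0 (begin
    m * a               ≡⟨ *-comm m a ⟩
    a * m               ≡⟨ x+y≡0⇒x≡-y (trans (≈⇒≡ (R.+-comm (a * m) 1#)) 1+am≡0) ⟩
    - 1#                ≡⟨ cong -_ (sym (*-inverseʳ m m≢0)) ⟩
    - (m * m ⁻¹[ m≢0 ]) ≡⟨ sym (-‿distribʳ-* m _) ⟩
    m * - m ⁻¹[ m≢0 ]   ∎)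

  pointOnLine-affine : ∀ {m a} b → 1# + a * m ≡ 0# → pointOnLine m b ≡ e1 a b
  pointOnLine-affine {m} {a} b 1+am≡0 with m ≟C 0#
  ... | yes m≡0 = ⊥-elim (0≢1 (sym (trans (sym (1+a0≡1 a)) (trans (cong (λ m → 1# + a * m) (sym m≡0)) 1+am≡0))))
    where
    1+a0≡1 : ∀ a → 1# + a * 0# ≡ 1#
    1+a0≡1 a = ≈⇒≡ (solve 1 (λ a → con 1 :+ a :* con 0 := con 1) R.refl a)
  ... | no m≢0 = cong (λ a → e1 a b) (sym (1+am≡0⇒a≡-m⁻¹ m≢0 1+am≡0))

  ·-slope : ∀ a b m → coords (e1 a b) · coords (e1 m 0#) ≡ 1# + a * m
  ·-slope a b m = ≈⇒≡ (solve 3 (λ a b m → con 1 :* con 1 :+ a :* m :+ b :* con 0 := con 1 :+ a :* m) R.refl a b m)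

  ·-slope-vertical : ∀ b m → coords (e2 b) · coords (e1 m 0#) ≡ m
  ·-slope-vertical b m = ≈⇒≡ (solve 2 (λ b m → con 0 :* con 1 :+ con 1 :* m :+ b :* con 0 := m) R.refl b m)

  ·-horizontal : ∀ a b → coords (e1 a b) · coords (e2 0#) ≡ a
  ·-horizontal a b = ≈⇒≡ (solve 2 (λ a b → con 1 :* con 0 :+ a :* con 1 :+ b :* con 0 := a) R.refl a b)

  ·-horizontal-vertical : ∀ b → coords (e2 b) · coords (e2 0#) ≡ 1#
  ·-horizontal-vertical b = ≈⇒≡ (solve 1 (λ b → con 0 :* con 0 :+ con 1 :* con 1 :+ b :* con 0 := con 1) R.refl b)

  e3-on-e1 : ∀ m → coords e3 · coords (e1 m 0#) ≡ 0#
  e3-on-e1 m = ≈⇒≡ (solve 1 (λ m → con 0 :* con 1 :+ con 0 :* m :+ con 1 :* con 0 := con 0) R.refl m)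

  e3-on-e2 : coords e3 · coords (e2 0#) ≡ 0#
  e3-on-e2 = ≈⇒≡ (solve 0 (con 0 :* con 0 :+ con 0 :* con 1 :+ con 1 :* con 0 := con 0) R.refl)

  -- The lines through e3 are x + m y = 0 and y = 0.
  pencilAtE3 : Pencil q
  pencilAtE3 = record
    { centre       = e3
    ; line         = line
    ; ray          = ray
    ; centre-on    = λ { zero    → ·≡0⇒I e3 (e2 0#) e3-on-e2
                       ; (suc i) → ·≡0⇒I e3 (e1 (element i) 0#) (e3-on-e1 (element i)) }
    ; ray-complete = ray-complete
    ; covers       = covers
    }
    where
    line : Fin (suc q) → NVec
    line zero    = e2 0#
    line (suc i) = e1 (element i) 0#

    ray : Fin (suc q) → Fin q → NVec
    ray zero    j = e1 0# (element j)
    ray (suc i) j = pointOnLine (element i) (element j)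

    ray-complete : ∀ i {x} → x I line i → x ≢ e3 → x ∈ᵥ ray i
    ray-complete zero    {e1 a b} x∈ℓ _ = index b ,
      cong₂ e1 (sym (trans (sym (·-horizontal a b)) (I⇒·≡0 (e1 a b) (e2 0#) x∈ℓ))) (element-index b)
    ray-complete zero    {e2 b}   x∈ℓ _ =
      ⊥-elim (0≢1 (sym (trans (sym (·-horizontal-vertical b)) (I⇒·≡0 (e2 b) (e2 0#) x∈ℓ))))
    ray-complete (suc i) {e1 a b} x∈ℓ _ = index b , trans (cong (pointOnLine _) (element-index b))
      (pointOnLine-affine b (trans (sym (·-slope a b _)) (I⇒·≡0 (e1 a b) (line (suc i)) x∈ℓ)))
    ray-complete (suc i) {e2 b}   x∈ℓ _ = index b , trans (cong (pointOnLine _) (element-index b))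
      (pointOnLine-vertical b (trans (sym (·-slope-vertical b _)) (I⇒·≡0 (e2 b) (line (suc i)) x∈ℓ)))
    ray-complete _       {e3}     _   x≢e3 = ⊥-elim (x≢e3 refl)

    covers : ∀ {x} → x ≢ e3 → ∃ λ i → x I line i
    covers {e1 a b} _ with a ≟C 0#
    ... | yes a≡0 = zero , ·≡0⇒I (e1 a b) (e2 0#) (trans (·-horizontal a b) a≡0)
    ... | no  a≢0 = suc (index (- a ⁻¹[ a≢0 ])) , ·≡0⇒I (e1 a b) (e1 (element (index (- a ⁻¹[ a≢0 ]))) 0#) (begin
      coords (e1 a b) · coords (e1 (element (index m)) 0#)  ≡⟨ ·-slope a b _ ⟩
      1# + a * element (index m)                            ≡⟨ cong (λ y → 1# + a * y) (element-index m) ⟩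
      1# + a * - a ⁻¹[ a≢0 ]                                ≡⟨ cong (1# +_) (-‿distribʳ-* a _) ⟩
      1# + - (a * a ⁻¹[ a≢0 ])                              ≡⟨ cong (λ y → 1# + - y) (*-inverseʳ a a≢0) ⟩
      1# + - 1#                                             ≡⟨ -‿inverseʳ 1# ⟩
      0#                                                    ∎)
      where
      m : Carrier
      m = - a ⁻¹[ a≢0 ]
    covers {e2 b} _ = suc (index 0#) ,
      ·≡0⇒I (e2 b) (e1 (element (index 0#)) 0#) (trans (·-slope-vertical b _) (element-index 0#))
    covers {e3} e3≢e3 = ⊥-elim (e3≢e3 refl)

  -- Cross-product rows: annᵢ u · v is the i-th coordinate of v × u, so each vanishes at u.
  ann₁ ann₂ ann₃ : V3 → V3
  ann₁ (u₁ , u₂ , u₃) = 0# , u₃ , - u₂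
  ann₂ (u₁ , u₂ , u₃) = - u₃ , 0# , u₁
  ann₃ (u₁ , u₂ , u₃) = u₂ , - u₁ , 0#

  ann₁-annihilates : ∀ u → u · ann₁ u ≡ 0#
  ann₁-annihilates (u₁ , u₂ , u₃) = trans
    (≈⇒≡ (solve 4 (λ u₁ u₂ u₃ n → u₁ :* con 0 :+ u₂ :* u₃ :+ u₃ :* n := u₂ :* u₃ :+ u₃ :* n) R.refl u₁ u₂ u₃ (- u₂)))
    (xy+y[-x]≡0 u₂ u₃)

  ann₂-annihilates : ∀ u → u · ann₂ u ≡ 0#
  ann₂-annihilates (u₁ , u₂ , u₃) = trans
    (≈⇒≡ (solve 4 (λ u₁ u₂ u₃ n → u₁ :* n :+ u₂ :* con 0 :+ u₃ :* u₁ := u₃ :* u₁ :+ u₁ :* n) R.refl u₁ u₂ u₃ (- u₃)))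
    (xy+y[-x]≡0 u₃ u₁)

  ann₃-annihilates : ∀ u → u · ann₃ u ≡ 0#
  ann₃-annihilates (u₁ , u₂ , u₃) = trans
    (≈⇒≡ (solve 4 (λ u₁ u₂ u₃ n → u₁ :* u₂ :+ u₂ :* n :+ u₃ :* con 0 := u₁ :* u₂ :+ u₂ :* n) R.refl u₁ u₂ u₃ (- u₁)))
    (xy+y[-x]≡0 u₁ u₂)

  -- x × p = 0: both span the same point, and its normal form is unique.
  annihilated⇒≡ : ∀ x p → coords x · ann₁ (coords p) ≡ 0# → coords x · ann₂ (coords p) ≡ 0# →
                  coords x · ann₃ (coords p) ≡ 0# → x ≡ p
  annihilated⇒≡ (e1 a b) (e1 c d) _ k₂ k₃ = cong₂ e1 (sym (x-y≡0⇒x≡y (begin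
    c + - a                   ≡⟨ cong (c +_) (sym (x*-1≡-x a)) ⟩
    c + a * - 1#              ≡⟨ ≈⇒≡ (solve 4 (λ a b c n → c :+ a :* n := con 1 :* c :+ a :* n :+ b :* con 0)
                                        R.refl a b c (- 1#)) ⟩
    1# * c + a * - 1# + b * 0# ≡⟨ k₃ ⟩
    0#                        ∎)))
    (x-y≡0⇒x≡y (trans (≈⇒≡ (solve 3 (λ a b n → b :+ n := con 1 :* n :+ a :* con 0 :+ b :* con 1)
                              R.refl a b (- d))) k₂))
  annihilated⇒≡ (e1 a b) (e2 d) _ _ k₃ = ⊥-elim (0≢1 (sym (begin
    1#                          ≡⟨ ≈⇒≡ (solve 2 (λ a b → con 1 := con 1 :* con 1 :+ a :* con 0 :+ b :* con 0)
                                          R.refl a b) ⟩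
    1# * 1# + a * 0# + b * 0#   ≡⟨ cong (λ z → 1# * 1# + a * z + b * 0#) (sym -0≡0) ⟩
    1# * 1# + a * - 0# + b * 0# ≡⟨ k₃ ⟩
    0#                          ∎)))
  annihilated⇒≡ (e1 a b) e3 _ k₂ _ = ⊥-elim (-1≢0
    (trans (≈⇒≡ (solve 3 (λ a b n → n := con 1 :* n :+ a :* con 0 :+ b :* con 0) R.refl a b (- 1#))) k₂))
  annihilated⇒≡ (e2 b) (e1 c d) _ _ k₃ = ⊥-elim (-1≢0
    (trans (≈⇒≡ (solve 3 (λ b c n → n := con 0 :* c :+ con 1 :* n :+ b :* con 0) R.refl b c (- 1#))) k₃))
  annihilated⇒≡ (e2 b) (e2 d) k₁ _ _ = cong e2 (sym (x-y≡0⇒x≡y (begin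
    d + - b                     ≡⟨ cong (d +_) (sym (x*-1≡-x b)) ⟩
    d + b * - 1#                ≡⟨ ≈⇒≡ (solve 3 (λ b d n → d :+ b :* n := con 0 :* con 0 :+ con 1 :* d :+ b :* n)
                                          R.refl b d (- 1#)) ⟩
    0# * 0# + 1# * d + b * - 1# ≡⟨ k₁ ⟩
    0#                          ∎)))
  annihilated⇒≡ (e2 b) e3 k₁ _ _ = ⊥-elim (0≢1 (sym (begin
    1#                          ≡⟨ ≈⇒≡ (solve 1 (λ b → con 1 := con 0 :* con 0 :+ con 1 :* con 1 :+ b :* con 0)
                                          R.refl b) ⟩
    0# * 0# + 1# * 1# + b * 0#  ≡⟨ cong (λ z → 0# * 0# + 1# * 1# + b * z) (sym -0≡0) ⟩
    0# * 0# + 1# * 1# + b * - 0# ≡⟨ k₁ ⟩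
    0#                          ∎)))
  annihilated⇒≡ e3 (e1 c d) _ k₂ _ = ⊥-elim (0≢1 (sym
    (trans (≈⇒≡ (solve 1 (λ n → con 1 := con 0 :* n :+ con 0 :* con 0 :+ con 1 :* con 1) R.refl (- d))) k₂)))
  annihilated⇒≡ e3 (e2 d) k₁ _ _ = ⊥-elim (-1≢0
    (trans (≈⇒≡ (solve 2 (λ d n → n := con 0 :* con 0 :+ con 0 :* d :+ con 1 :* n) R.refl d (- 1#))) k₁))
  annihilated⇒≡ e3 e3 _ _ _ = refl

  record Separating (x : NVec) (Q : Query) : Set where
    field
      functional : V3
      nonzero-at : coords x · functional ≢ 0#
      vanishes   : ∀ y → Accepts Q y → coords y · functional ≡ 0#

  accepts-pt : ∀ p y → Accepts (pt p) y → y ≡ p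
  accepts-pt p y y-accepts with y ≟N p | y-accepts
  ... | yes y≡p | _ = y≡p

  rejects-pt : ∀ p x → Rejects (pt p) x → x ≢ p
  rejects-pt p x x-rejects x≡p with x ≟N p | x-rejects
  ... | no x≢p | _ = x≢p x≡p

  pt-vanishes : ∀ p (ann : V3 → V3) → (∀ u → u · ann u ≡ 0#) →
                ∀ y → Accepts (pt p) y → coords y · ann (coords p) ≡ 0#
  pt-vanishes p ann annihilates y y-accepts rewrite accepts-pt p y y-accepts = annihilates (coords p)

  -- A point p ≠ x lies on the three lines annᵢ p, and x × p ≠ 0 puts x off one of them.
  separating : ∀ x Q → Rejects Q x → Separating x Q
  separating x (ln L) x∉L = record
    { functional = coords L ; nonzero-at = ¬I⇒·≢0 x L x∉L ; vanishes = λ y → I⇒·≡0 y L }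
  separating x (pt p) x≠p with (coords x · ann₁ (coords p)) ≟C 0#
  ... | no k₁≢0 = record
    { functional = ann₁ (coords p) ; nonzero-at = k₁≢0 ; vanishes = pt-vanishes p ann₁ ann₁-annihilates }
  ... | yes k₁≡0 with (coords x · ann₂ (coords p)) ≟C 0#
  ...   | no k₂≢0 = record
    { functional = ann₂ (coords p) ; nonzero-at = k₂≢0 ; vanishes = pt-vanishes p ann₂ ann₂-annihilates }
  ...   | yes k₂≡0 = record
    { functional = ann₃ (coords p)
    ; nonzero-at = λ k₃≡0 → rejects-pt p x x≠p (annihilated⇒≡ x p k₁≡0 k₂≡0 k₃≡0)
    ; vanishes = pt-vanishes p ann₃ ann₃-annihilates }

  infixl 6 _⊕_
  infixr 7 _⊛_

  _⊕_ : V3 → V3 → V3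
  (x₁ , x₂ , x₃) ⊕ (y₁ , y₂ , y₃) = x₁ + y₁ , x₂ + y₂ , x₃ + y₃

  _⊛_ : Carrier → V3 → V3
  c ⊛ (y₁ , y₂ , y₃) = c * y₁ , c * y₂ , c * y₃

  𝟎 : V3
  𝟎 = 0# , 0# , 0#

  ·-comm : ∀ u v → u · v ≡ v · u
  ·-comm (u₁ , u₂ , u₃) (v₁ , v₂ , v₃) = ≈⇒≡ (solve 6 (λ u₁ u₂ u₃ v₁ v₂ v₃ →
    u₁ :* v₁ :+ u₂ :* v₂ :+ u₃ :* v₃ := v₁ :* u₁ :+ v₂ :* u₂ :+ v₃ :* u₃) R.refl u₁ u₂ u₃ v₁ v₂ v₃)

  ·-⊕ : ∀ u v w → (u ⊕ v) · w ≡ u · w + v · w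
  ·-⊕ (u₁ , u₂ , u₃) (v₁ , v₂ , v₃) (w₁ , w₂ , w₃) = ≈⇒≡ (solve 9 (λ u₁ u₂ u₃ v₁ v₂ v₃ w₁ w₂ w₃ →
    (u₁ :+ v₁) :* w₁ :+ (u₂ :+ v₂) :* w₂ :+ (u₃ :+ v₃) :* w₃
      := (u₁ :* w₁ :+ u₂ :* w₂ :+ u₃ :* w₃) :+ (v₁ :* w₁ :+ v₂ :* w₂ :+ v₃ :* w₃)) R.refl u₁ u₂ u₃ v₁ v₂ v₃ w₁ w₂ w₃)

  ·-⊛ : ∀ c u w → (c ⊛ u) · w ≡ c * (u · w)
  ·-⊛ c (u₁ , u₂ , u₃) (w₁ , w₂ , w₃) = ≈⇒≡ (solve 7 (λ c u₁ u₂ u₃ w₁ w₂ w₃ →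
    c :* u₁ :* w₁ :+ c :* u₂ :* w₂ :+ c :* u₃ :* w₃ := c :* (u₁ :* w₁ :+ u₂ :* w₂ :+ u₃ :* w₃)) R.refl c u₁ u₂ u₃ w₁ w₂ w₃)

  𝟎-· : ∀ w → 𝟎 · w ≡ 0#
  𝟎-· (w₁ , w₂ , w₃) = ≈⇒≡ (solve 3 (λ w₁ w₂ w₃ → con 0 :* w₁ :+ con 0 :* w₂ :+ con 0 :* w₃ := con 0) R.refl w₁ w₂ w₃)

  nonzero-coordinate : ∀ v → v ≢ 𝟎 →
                       let (v₁ , v₂ , v₃) = v in v₁ ≢ 0# ⊎ v₁ ≡ 0# × (v₂ ≢ 0# ⊎ v₂ ≡ 0# × v₃ ≢ 0#)
  nonzero-coordinate (v₁ , v₂ , v₃) v≢𝟎 with v₁ ≟C 0# | v₂ ≟C 0# | v₃ ≟C 0#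
  ... | no v₁≢0 | _        | _        = inj₁ v₁≢0
  ... | yes v₁≡0 | no v₂≢0 | _        = inj₂ (v₁≡0 , inj₁ v₂≢0)
  ... | yes v₁≡0 | yes v₂≡0 | no v₃≢0 = inj₂ (v₁≡0 , inj₂ (v₂≡0 , v₃≢0))
  ... | yes refl | yes refl | yes refl = ⊥-elim (v≢𝟎 refl)

  y≡x*[y*x⁻¹] : ∀ y x (x≢0 : x ≢ 0#) → y ≡ x * (y * x ⁻¹[ x≢0 ])
  y≡x*[y*x⁻¹] y x x≢0 = sym (begin
    x * (y * x ⁻¹[ x≢0 ])  ≡⟨ ≈⇒≡ (solve 3 (λ x y i → x :* (y :* i) := y :* (x :* i)) R.refl x y (x ⁻¹[ x≢0 ])) ⟩
    y * (x * x ⁻¹[ x≢0 ])  ≡⟨ cong (y *_) (*-inverseʳ x x≢0) ⟩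
    y * 1#                 ≡⟨ *-identityʳ y ⟩
    y                      ∎)

  normalise : ∀ v → v ≢ 𝟎 → Σ NVec λ y → Σ Carrier λ μ → v ≡ μ ⊛ coords y
  normalise (v₁ , v₂ , v₃) v≢𝟎 with nonzero-coordinate (v₁ , v₂ , v₃) v≢𝟎
  ... | inj₁ v₁≢0 = e1 (v₂ * v₁ ⁻¹[ v₁≢0 ]) (v₃ * v₁ ⁻¹[ v₁≢0 ]) , v₁ ,
    cong₂ _,_ (sym (*-identityʳ v₁)) (cong₂ _,_ (y≡x*[y*x⁻¹] v₂ v₁ v₁≢0) (y≡x*[y*x⁻¹] v₃ v₁ v₁≢0))
  ... | inj₂ (refl , inj₁ v₂≢0) = e2 (v₃ * v₂ ⁻¹[ v₂≢0 ]) , v₂ ,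
    cong₂ _,_ (sym (zeroʳ v₂)) (cong₂ _,_ (sym (*-identityʳ v₂)) (y≡x*[y*x⁻¹] v₃ v₂ v₂≢0))
  ... | inj₂ (refl , inj₂ (refl , v₃≢0)) = e3 , v₃ ,
    cong₂ _,_ (sym (zeroʳ v₃)) (cong₂ _,_ (sym (zeroʳ v₃)) (sym (*-identityʳ v₃)))

  Independent : V3 → V3 → Set
  Independent a b = ∀ s t → s ⊛ a ⊕ t ⊛ b ≡ 𝟎 → s ≡ 0# × t ≡ 0#

  sc+t0≡0⇒s≡0 : ∀ {c s t} → c ≢ 0# → s * c + t * 0# ≡ 0# → s ≡ 0#
  sc+t0≡0⇒s≡0 {c} {s} {t} c≢0 eq = x*y≡0⇒y≡0 c≢0
    (trans (≈⇒≡ (solve 3 (λ c s t → c :* s := s :* c :+ t :* con 0) R.refl c s t)) eq)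

  s0+tc≡0⇒t≡0 : ∀ {c s t} → c ≢ 0# → s * 0# + t * c ≡ 0# → t ≡ 0#
  s0+tc≡0⇒t≡0 {c} {s} {t} c≢0 eq = x*y≡0⇒y≡0 c≢0
    (trans (≈⇒≡ (solve 3 (λ c s t → c :* t := s :* con 0 :+ t :* c) R.refl c s t)) eq)

  kernel : ∀ (ann : V3 → V3) → (∀ u → u · ann u ≡ 0#) → ∀ w → ann w · w ≡ 0#
  kernel ann annihilates w = trans (·-comm (ann w) w) (annihilates w)

  kernelBasis : ∀ w → w ≢ 𝟎 → Σ V3 λ a → Σ V3 λ b → a · w ≡ 0# × b · w ≡ 0# × Independent a b
  kernelBasis w w≢𝟎 with nonzero-coordinate w w≢𝟎
  ... | inj₁ w₁≢0 =
    ann₂ w , ann₃ w , kernel ann₂ ann₂-annihilates w , kernel ann₃ ann₃-annihilates w ,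
    λ s t eq → sc+t0≡0⇒s≡0 w₁≢0 (cong (proj₂ ∘ proj₂) eq) , s0+tc≡0⇒t≡0 (-x≢0 w₁≢0) (cong (proj₁ ∘ proj₂) eq)
  ... | inj₂ (refl , inj₁ w₂≢0) =
    ann₁ w , ann₃ w , kernel ann₁ ann₁-annihilates w , kernel ann₃ ann₃-annihilates w ,
    λ s t eq → sc+t0≡0⇒s≡0 (-x≢0 w₂≢0) (cong (proj₂ ∘ proj₂) eq) , s0+tc≡0⇒t≡0 w₂≢0 (cong proj₁ eq)
  ... | inj₂ (refl , inj₂ (refl , w₃≢0)) =
    ann₁ w , ann₂ w , kernel ann₁ ann₁-annihilates w , kernel ann₂ ann₂-annihilates w ,
    λ s t eq → sc+t0≡0⇒s≡0 w₃≢0 (cong (proj₁ ∘ proj₂) eq) , s0+tc≡0⇒t≡0 (-x≢0 w₃≢0) (cong proj₁ eq)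

  ⊕-cancel : ∀ u v → u ≡ u ⊕ v → v ≡ 𝟎
  ⊕-cancel (u₁ , u₂ , u₃) (v₁ , v₂ , v₃) eq = cong₂ _,_ (x≡x+y⇒y≡0 (cong proj₁ eq))
    (cong₂ _,_ (x≡x+y⇒y≡0 (cong (proj₁ ∘ proj₂) eq)) (x≡x+y⇒y≡0 (cong (proj₂ ∘ proj₂) eq)))

  1⊛ : ∀ v → 1# ⊛ v ≡ v
  1⊛ (v₁ , v₂ , v₃) = cong₂ _,_ (*-identityˡ v₁) (cong₂ _,_ (*-identityˡ v₂) (*-identityˡ v₃))

  ·≢0⇒≢𝟎 : ∀ u w → u · w ≢ 0# → w ≢ 𝟎
  ·≢0⇒≢𝟎 u w u·w≢0 refl = u·w≢0 (trans (·-comm u 𝟎) (𝟎-· u))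

  -- For x · w₀ ≠ 0, the points x + s a + t b with a, b spanning ker w₀ are the affine
  -- plane off the line w₀ = 0, with x at the origin (s, t) = (0, 0).
  module AffineChart (x : NVec) (w₀ : V3) (x·w₀≢0 : coords x · w₀ ≢ 0#) (a b : V3)
                     (a·w₀≡0 : a · w₀ ≡ 0#) (b·w₀≡0 : b · w₀ ≡ 0#) (independent : Independent a b) where

    vector : Carrier → Carrier → V3
    vector s t = coords x ⊕ (s ⊛ a ⊕ t ⊛ b)

    formOf : V3 → AffineForm
    formOf w = affine (coords x · w) (a · w) (b · w)

    vector-· : ∀ s t w → vector s t · w ≡ formOf w ⟨ s , t ⟩
    vector-· s t w = begin
      (coords x ⊕ (s ⊛ a ⊕ t ⊛ b)) · w          ≡⟨ ·-⊕ (coords x) _ w ⟩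
      coords x · w + (s ⊛ a ⊕ t ⊛ b) · w        ≡⟨ cong (coords x · w +_) (trans (·-⊕ (s ⊛ a) (t ⊛ b) w)
                                                     (cong₂ _+_ (·-⊛ s a w) (·-⊛ t b w))) ⟩
      coords x · w + (s * (a · w) + t * (b · w)) ≡⟨ ≈⇒≡ (solve 5 (λ c α β s t →
                                                       c :+ (s :* α :+ t :* β) := c :+ α :* s :+ β :* t)
                                                     R.refl (coords x · w) (a · w) (b · w) s t) ⟩
      affine (coords x · w) (a · w) (b · w) ⟨ s , t ⟩ ∎

    vector-·w₀ : ∀ s t → vector s t · w₀ ≡ coords x · w₀
    vector-·w₀ s t = begin
      vector s t · w₀                                  ≡⟨ vector-· s t w₀ ⟩
      coords x · w₀ + a · w₀ * s + b · w₀ * t          ≡⟨ cong₂ (λ α β → coords x · w₀ + α * s + β * t)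
                                                              a·w₀≡0 b·w₀≡0 ⟩
      coords x · w₀ + 0# * s + 0# * t                  ≡⟨ ≈⇒≡ (solve 3 (λ c s t → c :+ con 0 :* s :+ con 0 :* t := c)
                                                                 R.refl _ s t) ⟩
      coords x · w₀                                    ∎

    vector≢𝟎 : ∀ s t → vector s t ≢ 𝟎
    vector≢𝟎 s t v≡𝟎 = x·w₀≢0 (trans (sym (vector-·w₀ s t)) (trans (cong (_· w₀) v≡𝟎) (𝟎-· w₀)))

    point : Carrier → Carrier → NVec
    point s t = proj₁ (normalise (vector s t) (vector≢𝟎 s t))

    scale : Carrier → Carrier → Carrier
    scale s t = proj₁ (proj₂ (normalise (vector s t) (vector≢𝟎 s t)))

    vector≡scale⊛point : ∀ s t → vector s t ≡ scale s t ⊛ coords (point s t)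
    vector≡scale⊛point s t = proj₂ (proj₂ (normalise (vector s t) (vector≢𝟎 s t)))

    point-vanishes : ∀ s t w → coords (point s t) · w ≡ 0# → vector s t · w ≡ 0#
    point-vanishes s t w y·w≡0 = begin
      vector s t · w                         ≡⟨ cong (_· w) (vector≡scale⊛point s t) ⟩
      (scale s t ⊛ coords (point s t)) · w   ≡⟨ ·-⊛ (scale s t) _ w ⟩
      scale s t * (coords (point s t) · w)   ≡⟨ cong (scale s t *_) y·w≡0 ⟩
      scale s t * 0#                         ≡⟨ zeroʳ _ ⟩
      0#                                     ∎

    point≢x : ∀ s t → ¬ (s ≡ 0# × t ≡ 0#) → point s t ≢ x
    point≢x s t st≢0 point≡x = st≢0 (independent s t
      (⊕-cancel (coords x) _ (sym (trans vector≡scale⊛x (trans (cong (_⊛ coords x) scale≡1) (1⊛ (coords x)))))))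
      where
      vector≡scale⊛x : vector s t ≡ scale s t ⊛ coords x
      vector≡scale⊛x = trans (vector≡scale⊛point s t) (cong (λ y → scale s t ⊛ coords y) point≡x)

      scale≡1 : scale s t ≡ 1#
      scale≡1 = sym (*-cancelˡ x·w₀≢0 (begin
        coords x · w₀ * 1#               ≡⟨ *-identityʳ _ ⟩
        coords x · w₀                    ≡⟨ sym (vector-·w₀ s t) ⟩
        vector s t · w₀                  ≡⟨ cong (_· w₀) vector≡scale⊛x ⟩
        (scale s t ⊛ coords x) · w₀      ≡⟨ ·-⊛ (scale s t) (coords x) w₀ ⟩
        scale s t * (coords x · w₀)      ≡⟨ *-comm (scale s t) _ ⟩
        coords x · w₀ * scale s t        ∎))

  module SeparatedPoint (x : NVec) (Q₀ : Query) (x-rejects₀ : Rejects Q₀ x) where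
    open Separating (separating x Q₀ x-rejects₀)
      renaming (functional to w₀; nonzero-at to x·w₀≢0; vanishes to w₀-vanishes)

    -- On the chart off the line w₀ = 0 every other query accepts only points of an
    -- affine line missing the origin x, and these lines cover the rest of the chart.
    separators≥2q-2 : ∀ C → All (λ Q → Rejects Q x) C →
                      (∀ y → y ≢ x → Any (λ Q → Accepts Q y) (Q₀ ∷ C)) → q ℕ.+ q ≤ 2 ℕ.+ length C
    separators≥2q-2 C x-rejects separated
      with a , b , a·w₀≡0 , b·w₀≡0 , independent ← kernelBasis w₀ (·≢0⇒≢𝟎 (coords x) w₀ x·w₀≢0) =
      subst (λ n → q ℕ.+ q ≤ 2 ℕ.+ n) (length-forms x-rejects)
        (covering-bound (forms x-rejects) (forms-const≢0 x-rejects) covered)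
      where
      open AffineChart x w₀ x·w₀≢0 a b a·w₀≡0 b·w₀≡0 independent

      functionalOf : ∀ Q → Rejects Q x → V3
      functionalOf Q x-rejects = Separating.functional (separating x Q x-rejects)

      forms : ∀ {C} → All (λ Q → Rejects Q x) C → List AffineForm
      forms []                               = []
      forms {Q ∷ _} (x-rejects ∷ x-rejects′) = formOf (functionalOf Q x-rejects) ∷ forms x-rejects′

      length-forms : ∀ {C} (x-rejects : All (λ Q → Rejects Q x) C) → length (forms x-rejects) ≡ length C
      length-forms []               = refl
      length-forms (_ ∷ x-rejects′) = cong suc (length-forms x-rejects′)

      forms-const≢0 : ∀ {C} (x-rejects : All (λ Q → Rejects Q x) C) →
                      All (λ f → AffineForm.const f ≢ 0#) (forms x-rejects)
      forms-const≢0 []                             = []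
      forms-const≢0 {Q ∷ _} (x-rejects ∷ x-rejects′) =
        Separating.nonzero-at (separating x Q x-rejects) ∷ forms-const≢0 x-rejects′

      ∏-vanishes : ∀ {C s t} (x-rejects : All (λ Q → Rejects Q x) C) →
                   Any (λ Q → Accepts Q (point s t)) C → ∏ (forms x-rejects) s t ≡ 0#
      ∏-vanishes {Q ∷ _} {s} {t} (x-rejects ∷ x-rejects′) (here accepts) =
        trans (cong (_* ∏ (forms x-rejects′) s t) (trans (sym (vector-· s t w))
                (point-vanishes s t w (Separating.vanishes (separating x Q x-rejects) (point s t) accepts))))
              (zeroˡ _)
        where
        w : V3
        w = functionalOf Q x-rejects
      ∏-vanishes {Q ∷ _} {s} {t} (x-rejects ∷ x-rejects′) (there accepted) =
        trans (cong (formOf (functionalOf Q x-rejects) ⟨ s , t ⟩ *_) (∏-vanishes x-rejects′ accepted)) (zeroʳ _)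

      covered : ∀ s t → ¬ (s ≡ 0# × t ≡ 0#) → ∏ (forms x-rejects) s t ≡ 0#
      covered s t st≢0 = by-separation (separated (point s t) (point≢x s t st≢0))
        where
        by-separation : Any (λ Q → Accepts Q (point s t)) (Q₀ ∷ C) → ∏ (forms x-rejects) s t ≡ 0#
        by-separation (here accepts₀) = ⊥-elim (x·w₀≢0 (trans (sym (vector-·w₀ s t))
                                          (point-vanishes s t w₀ (w₀-vanishes (point s t) accepts₀))))
        by-separation (there accepted) = ∏-vanishes x-rejects accepted

  elements : List Carrier
  elements = map element (allFin q)

  ∈-elements : ∀ c → c ∈ elements
  ∈-elements c = subst (_∈ elements) (element-index c) (∈-map⁺ element (∈-allFin (index c)))

  points : List NVec
  points = cartesianProductWith e1 elements elements ++ map e2 elements ++ e3 ∷ []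

  ∈-points : ∀ y → y ∈ points
  ∈-points (e1 a b) = ∈-++⁺ˡ (∈-cartesianProductWith⁺ e1 (∈-elements a) (∈-elements b))
  ∈-points (e2 b)   = ∈-++⁺ʳ (cartesianProductWith e1 elements elements) (∈-++⁺ˡ (∈-map⁺ e2 (∈-elements b)))
  ∈-points e3       = ∈-++⁺ʳ (cartesianProductWith e1 elements elements) (∈-++⁺ʳ (map e2 elements) (here refl))

  another : ∀ (x : NVec) → ∃ λ (y : NVec) → y ≢ x
  another e3       = e2 0# , λ ()
  another (e1 _ _) = e3 , λ ()
  another (e2 _)   = e3 , λ ()

  PG-A≥ : ∀ T → Determines T → 2 ℕ.* q ∸ 1 ≤ depth T
  PG-A≥ T determines with separator T (∈-points e3) (λ {y} _ → determines y)
  ... | record { point = x ; queries = [] ; separated = separated }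
    with () ← separated (∈-points (proj₁ (another x))) (proj₂ (another x))
  ... | record { point = x ; queries = Q₀ ∷ C ; few = few
               ; rejected = x-rejects₀ ∷ x-rejects ; separated = separated } =
    ≤-trans (2q≤2+n⇒2q∸1≤1+n {q}
              (SeparatedPoint.separators≥2q-2 x Q₀ x-rejects₀ C x-rejects (λ y → separated (∈-points y))))
            few

  PG-A≡ : A≡ (2 ℕ.* q ∸ 1)
  PG-A≡ = pencil-A≤ 2≤q pencilAtE3 , PG-A≥

theorem1p1 : ((q : ℕ) (π : ProjectivePlane q) →
                Search.A≤ (ProjectivePlane.S π) (2 ℕ.* q ∸ 1))
             × ((q : ℕ) (F : CommutativeRing 0ℓ 0ℓ) (isFF : IsFiniteField q F) →
                Search.A≡ (PG2.PG F isFF) (2 ℕ.* q ∸ 1))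
theorem1p1 = (λ q π → PlaneSearch.plane-A≤ π) , (λ q F isFF → Desarguesian.PG-A≡ F isFF)
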